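{- Let $n\ge 0$ and $m>1$ be integers. Then $$sp(nm+1,m)=sp(nm+2,m)=\cdots=sp(nm+m-1,m)=1+2\sum_{j=1}^{n} sp(j,m).$$
   Context: For fixed $m>1$, $sp(n,m)$ is defined by: $sp(n,m)=0$ for $n<0$, $sp(0,m)=1$, $sp(n,m)=1$ for $1\le n\le m-1$, and for $n\ge m$: $sp(n,m)=sp(n/m,m)$ if $m\mid n$, and $sp(n,m)=2sp(n-r,m)+sp(n-m,m)$ if $n\equiv r\pmod m$ with $0<r<m$. (It counts semi-$m$-Pell compositions of $n$.) -}

module Defs where

open import Data.Nat using (ℕ; zero; suc; _+_; _*_; _∸_; _<ᵇ_)
open import Data.Nat.DivMod using (_/_; _%_)
open import Data.Bool using (if_then_else_)

-- sp(n,m) for m > 1 (we only ever use it for m ≥ 2; m is passed as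
-- suc (suc k) so that division is well defined).
-- Defined with a fuel argument; sp n m uses fuel (suc n), which is always
-- enough since every recursive call (n/m, n - r, n - m, all for n ≥ m > 1)
-- is on a strictly smaller natural number.  The case n < 0 of the paper
-- never arises on ℕ: in the recursion n ≥ m so n - m ≥ 0.
spF : ℕ → ℕ → ℕ → ℕ
spF zero    n k = 1   -- unreachable with sufficient fuel
spF (suc f) n k =
  let m = suc (suc k) in
  if n <ᵇ m then 1
  else (let r = n % m in
        if r <ᵇ 1 then spF f (n / m) k
        else 2 * spF f (n ∸ r) k + spF f (n ∸ m) k)

sp : (n m : ℕ) → ℕ
sp n zero          = 0  -- m ≤ 1 not in scope of the definition; junk value
sp n (suc zero)    = 0
sp n (suc (suc k)) = spF (suc n) n k

sumFrom1 : (ℕ → ℕ) → ℕ → ℕ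
sumFrom1 f zero    = 0
sumFrom1 f (suc n) = sumFrom1 f n + f (suc n)

-- Writing N = (n+1)m + r with 0 < r < m, the recursion gives
-- sp(N) = 2 sp((n+1)m) + sp(N − m) = 2 sp(n+1) + sp(nm + r), since m ∣ (n+1)m and
-- sp(jm) = sp(j).  Unrolling down to sp(r) = 1 yields 1 + 2 Σ_{j=1}^{n+1} sp(j),
-- independently of r.
module Submission where

open import Defs
open import Data.Bool using (true; false; T; if_then_else_)
open import Data.Nat
open import Data.Nat.DivMod
open import Data.Nat.Properties
open import Relation.Binary.PropositionalEquality
open import Relation.Nullary using (contradiction)

<⇒<ᵇ≡true : ∀ {a b} → a < b → (a <ᵇ b) ≡ true
<⇒<ᵇ≡true {a} {b} a<b with a <ᵇ b | <⇒<ᵇ a<b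
... | true | _ = refl

≤⇒<ᵇ≡false : ∀ {a b} → b ≤ a → (a <ᵇ b) ≡ false
≤⇒<ᵇ≡false {a} {b} b≤a with a <ᵇ b in eq
... | false = refl
... | true  = contradiction (<ᵇ⇒< a b (subst T (sym eq) _)) (≤⇒≯ b≤a)

<ᵇ≡false⇒≥ : ∀ {a b} → (a <ᵇ b) ≡ false → b ≤ a
<ᵇ≡false⇒≥ eq = ≮⇒≥ (λ a<b → subst T eq (<⇒<ᵇ a<b))

module _ (k : ℕ) where

  private
    m : ℕ
    m = suc (suc k)

  n/m<n : ∀ {n} → m ≤ n → n / m < n
  n/m<n {n@(suc _)} _ = m/n<m n m (s≤s (s≤s z≤n))

  -- The body of spF with its recursive calls delegated to rec:
  -- spF (suc f) n k reduces to spStep (λ x → spF f x k) n.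
  spStep : (ℕ → ℕ) → ℕ → ℕ
  spStep rec n =
    if n <ᵇ m then 1
    else if n % m <ᵇ 1 then rec (n / m)
    else 2 * rec (n ∸ n % m) + rec (n ∸ m)

  spStep-cong : ∀ {rec rec′} n → (∀ {x} → x < n → rec x ≡ rec′ x) →
                spStep rec n ≡ spStep rec′ n
  spStep-cong n agree with n <ᵇ m in n≮m | n % m <ᵇ 1 in r≮1
  ... | true  | _     = refl
  ... | false | true  = agree (n/m<n (<ᵇ≡false⇒≥ n≮m))
  ... | false | false = cong₂ (λ a b → 2 * a + b)
    (agree (∸-monoʳ-< (<ᵇ≡false⇒≥ r≮1) (m%n≤m n m)))
    (agree (∸-monoʳ-< z<s (<ᵇ≡false⇒≥ n≮m)))

  spF-fuel : ∀ f g n → n < f → n < g → spF f n k ≡ spF g n k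
  spF-fuel (suc f) (suc g) n n<f n<g = spStep-cong n λ x<n →
    spF-fuel f g _ (<-≤-trans x<n (s≤s⁻¹ n<f)) (<-≤-trans x<n (s≤s⁻¹ n<g))

  sp-unfold : ∀ n → sp n m ≡ spStep (λ x → sp x m) n
  sp-unfold n = spStep-cong n λ {x} x<n → spF-fuel n (suc x) x x<n ≤-refl

  sp-< : ∀ {n} → n < m → sp n m ≡ 1
  sp-< {n} n<m rewrite <⇒<ᵇ≡true n<m = refl

  sp-divisible : ∀ {n} → m ≤ n → n % m ≡ 0 → sp n m ≡ sp (n / m) m
  sp-divisible {n} m≤n n%m≡0 rewrite sp-unfold n | ≤⇒<ᵇ≡false m≤n | n%m≡0 = refl

  sp-nondivisible : ∀ {n} → m ≤ n → 0 < n % m →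
                    sp n m ≡ 2 * sp (n ∸ n % m) m + sp (n ∸ m) m
  sp-nondivisible {n} m≤n 0<r
    rewrite sp-unfold n | ≤⇒<ᵇ≡false m≤n | ≤⇒<ᵇ≡false {n % m} 0<r = refl

  sp-*m : ∀ n → sp (n * m) m ≡ sp n m
  sp-*m zero    = refl
  sp-*m (suc n) = begin
    sp (suc n * m) m          ≡⟨ sp-divisible (m≤m+n m (n * m)) (m*n%n≡0 (suc n) m) ⟩
    sp (suc n * m / m) m      ≡⟨ cong (λ x → sp x m) (m*n/n≡m (suc n) m) ⟩
    sp (suc n) m              ∎
    where open ≡-Reasoning

  sp-step : ∀ n {r} → 0 < r → r < m →
            sp (suc n * m + r) m ≡ 2 * sp (suc n) m + sp (n * m + r) m
  sp-step n {r} 0<r r<m = begin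
    sp N m                                  ≡⟨ sp-nondivisible m≤N (subst (0 <_) (sym N%m≡r) 0<r) ⟩
    2 * sp (N ∸ N % m) m + sp (N ∸ m) m     ≡⟨ cong₂ (λ a b → 2 * sp a m + sp b m) N∸r N∸m ⟩
    2 * sp (suc n * m) m + sp (n * m + r) m ≡⟨ cong (λ a → 2 * a + sp (n * m + r) m) (sp-*m (suc n)) ⟩
    2 * sp (suc n) m + sp (n * m + r) m     ∎
    where
    open ≡-Reasoning
    N = suc n * m + r
    m≤N : m ≤ N
    m≤N = ≤-trans (m≤m+n m (n * m)) (m≤m+n (suc n * m) r)
    N%m≡r : N % m ≡ r
    N%m≡r = begin
      (suc n * m + r) % m ≡⟨ cong (_% m) (+-comm (suc n * m) r) ⟩
      (r + suc n * m) % m ≡⟨ [m+kn]%n≡m%n r (suc n) m ⟩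
      r % m               ≡⟨ m<n⇒m%n≡m r<m ⟩
      r                   ∎
    N∸r : N ∸ N % m ≡ suc n * m
    N∸r = trans (cong (N ∸_) N%m≡r) (m+n∸n≡m (suc n * m) r)
    N∸m : N ∸ m ≡ n * m + r
    N∸m = trans (cong (_∸ m) (+-assoc m (n * m) r)) (m+n∸m≡n m (n * m + r))

theorem3p5 : (n m : ℕ) → 1 < m → (r : ℕ) → 1 ≤ r → r < m →
    sp (n * m + r) m ≡ 1 + 2 * sumFrom1 (λ j → sp j m) n
theorem3p5 _       1               (s≤s ()) _ _ _
theorem3p5 zero    m@(suc (suc k)) _   r _   r<m = sp-< k r<m
theorem3p5 (suc n) m@(suc (suc k)) 1<m r 0<r r<m = begin
  sp (suc n * m + r) m                 ≡⟨ sp-step k n 0<r r<m ⟩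
  2 * sp (suc n) m + sp (n * m + r) m  ≡⟨ cong (2 * sp (suc n) m +_) (theorem3p5 n m 1<m r 0<r r<m) ⟩
  2 * sp (suc n) m + (1 + 2 * S)       ≡⟨ +-comm (2 * sp (suc n) m) (1 + 2 * S) ⟩
  1 + (2 * S + 2 * sp (suc n) m)       ≡⟨ cong suc (*-distribˡ-+ 2 S (sp (suc n) m)) ⟨
  1 + 2 * (S + sp (suc n) m)           ∎
  where
  open ≡-Reasoning
  S = sumFrom1 (λ j → sp j m) n
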